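{- Let $G$ be a graph and fix $v\in V(G)$. Suppose that (i) $D(G,x)$, $D(G_v^{(1)},x)$, $D(G_v^{(2)},x)$, $D(G_v^{(3)},x)$ are unimodal with modes at $\mu_0,\mu_1,\mu_2,\mu_3$ respectively, and (ii) $0\le \mu_i-\mu_{i-1}\le 1$ for $i\in\{1,2,3\}$. Then $D(G_v^{(\ell)},x)$ is unimodal for all $\ell\in\mathbb{N}$.
   Context: $G$ is a finite simple graph. For $\ell\ge1$, $G_v^{(\ell)}$ denotes the graph obtained from $G$ by adding a new path on $\ell$ vertices and an edge between $v$ and a leaf (endpoint) of that path; $G_v^{(0)}:=G$. A set $U$ of vertices is dominating if every vertex is in $U$ or adjacent to a vertex of $U$; $d_i$ counts dominating sets of size $i$ and $D(H,x)=\sum_i d_i(H)x^i$ is the domination polynomial. A polynomial is unimodal if its coefficients (ordered by increasing power of $x$) are non-decreasing then non-increasing; it has a mode at $k$ if the coefficient of $x^k$ is maximum. -}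

module Defs where

open import Data.Nat using (ℕ; zero; suc; _+_; _≤_; _≟_)
open import Data.Bool using (Bool; true; false; T; _∧_; _∨_)
open import Data.Fin using (Fin; toℕ; splitAt)
open import Data.Fin.Subset using (Subset; _∈_; ∣_∣; inside; outside)
open import Data.Fin.Subset.Properties using (_∈?_)
open import Data.Fin.Properties using (all?; any?)
open import Data.Vec using ([]; _∷_)
open import Data.List using (List; []; _∷_; map; _++_; filter; length)
open import Data.Product using (_×_; ∃; _,_)
open import Data.Sum using (_⊎_)
open import Relation.Nullary using (Dec; yes; no)
open import Relation.Nullary.Decidable using (_×-dec_; _⊎-dec_)
open import Relation.Binary.PropositionalEquality using (_≡_)

record Graph : Set where
  field
    n     : ℕ
    adj   : Fin n → Fin n → Bool
    sym   : ∀ x y → adj x y ≡ adj y x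
    irrefl : ∀ x → adj x x ≡ false
open Graph public

V : Graph → Set
V G = Fin (n G)

Adj : (G : Graph) → V G → V G → Set
Adj G x y = T (adj G x y)

_==_ : ℕ → ℕ → Bool
zero == zero = true
zero == suc _ = false
suc _ == zero = false
suc a == suc b = a == b

consec : ℕ → ℕ → Bool
consec a b = (suc a == b) ∨ (suc b == a)

-- Adjacency of G_v^(ℓ): vertices Fin (n + ℓ); the first n are the vertices
-- of G, vertex n + p (p < ℓ) is the p-th vertex of the new path
-- (path p — p+1), and v is joined to the path leaf p = 0.
extAdj : (G : Graph) → V G → (ℓ : ℕ) → Fin (n G + ℓ) → Fin (n G + ℓ) → Bool
extAdj G v ℓ x y with splitAt (n G) x | splitAt (n G) y
... | Data.Sum.inj₁ a | Data.Sum.inj₁ b = adj G a b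
... | Data.Sum.inj₂ p | Data.Sum.inj₂ q = consec (toℕ p) (toℕ q)
... | Data.Sum.inj₁ a | Data.Sum.inj₂ q = (toℕ a == toℕ v) ∧ (toℕ q == 0)
... | Data.Sum.inj₂ p | Data.Sum.inj₁ b = (toℕ b == toℕ v) ∧ (toℕ p == 0)

private
  ==-refl : ∀ a → (a == a) ≡ true
  ==-refl zero = Relation.Binary.PropositionalEquality.refl
  ==-refl (suc a) = ==-refl a

  suc-neq : ∀ a → (suc a == a) ≡ false
  suc-neq zero = Relation.Binary.PropositionalEquality.refl
  suc-neq (suc a) = suc-neq a

  ∨-comm : ∀ a b → (a ∨ b) ≡ (b ∨ a)
  ∨-comm false false = Relation.Binary.PropositionalEquality.refl
  ∨-comm false true = Relation.Binary.PropositionalEquality.refl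
  ∨-comm true false = Relation.Binary.PropositionalEquality.refl
  ∨-comm true true = Relation.Binary.PropositionalEquality.refl

extAdj-sym : (G : Graph) (v : V G) (ℓ : ℕ) → ∀ x y → extAdj G v ℓ x y ≡ extAdj G v ℓ y x
extAdj-sym G v ℓ x y with splitAt (n G) x | splitAt (n G) y
... | Data.Sum.inj₁ a | Data.Sum.inj₁ b = sym G a b
... | Data.Sum.inj₂ p | Data.Sum.inj₂ q = ∨-comm (suc (toℕ p) == toℕ q) (suc (toℕ q) == toℕ p)
... | Data.Sum.inj₁ a | Data.Sum.inj₂ q = Relation.Binary.PropositionalEquality.refl
... | Data.Sum.inj₂ p | Data.Sum.inj₁ b = Relation.Binary.PropositionalEquality.refl

extAdj-irrefl : (G : Graph) (v : V G) (ℓ : ℕ) → ∀ x → extAdj G v ℓ x x ≡ false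
extAdj-irrefl G v ℓ x with splitAt (n G) x
... | Data.Sum.inj₁ a = irrefl G a
... | Data.Sum.inj₂ p rewrite suc-neq (toℕ p) = Relation.Binary.PropositionalEquality.refl

-- G_v^(ℓ)  (for ℓ = 0 this is G with vertex set Fin (n + 0), no new vertices)
attachPath : (G : Graph) → V G → ℕ → Graph
attachPath G v ℓ = record
  { n = n G + ℓ
  ; adj = extAdj G v ℓ
  ; sym = extAdj-sym G v ℓ
  ; irrefl = extAdj-irrefl G v ℓ }

Dominating : (G : Graph) → Subset (n G) → Set
Dominating G U = ∀ x → x ∈ U ⊎ ∃ λ y → y ∈ U × Adj G x y

Adj? : (G : Graph) → ∀ x y → Dec (Adj G x y)
Adj? G x y with adj G x y
... | true = yes Data.Unit.tt
  where import Data.Unit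
... | false = no (λ ())

dominating? : (G : Graph) → (U : Subset (n G)) → Dec (Dominating G U)
dominating? G U = all? (λ x → (x ∈? U) ⊎-dec any? (λ y → (y ∈? U) ×-dec Adj? G x y))

allSubsets : (m : ℕ) → List (Subset m)
allSubsets zero = [] ∷ []
allSubsets (suc m) = map (outside ∷_) (allSubsets m) ++ map (inside ∷_) (allSubsets m)

-- d_i(G): number of dominating sets of G of size i
-- (the coefficient sequence of the domination polynomial D(G,x))
d : Graph → ℕ → ℕ
d G i = length (filter (λ U → (∣ U ∣ ≟ i) ×-dec dominating? G U) (allSubsets (n G)))

Unimodal : (ℕ → ℕ) → Set
Unimodal a = ∃ λ k → (∀ i j → i ≤ j → j ≤ k → a i ≤ a j)
                   × (∀ i j → k ≤ i → i ≤ j → a j ≤ a i)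

ModeAt : (ℕ → ℕ) → ℕ → Set
ModeAt a k = ∀ i → a i ≤ a k

-- Split a dominating set of G_v^(ℓ) into its part U ⊆ V(G) and its part W on the path p₀ … p_{ℓ-1};
-- whether U ++ W dominates depends on U only through three bits (U dominates G; U dominates G
-- once v is covered; v ∈ U), and the W-sum obeys a transfer recursion along the path.  This
-- gives D(G_v^(ℓ+3)) = x (D(G_v^(ℓ+2)) + D(G_v^(ℓ+1)) + D(G_v^(ℓ))).
--
-- Now let D_ℓ, …, D_{ℓ+3} have peaks μ₀ ≤ μ₁ ≤ μ₂ ≤ μ₃.  The sum D_{ℓ+3} + D_{ℓ+2} + D_{ℓ+1}
-- falls from μ₃ on, and it rises up to μ₃ - 1: below μ₁ every summand rises, and from μ₁ on
-- the coefficient identity D_{ℓ+3}(i+1) = (D_{ℓ+2} + D_{ℓ+1} + D_ℓ)(i), the rise of D_{ℓ+3}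
-- and the fall of D_ℓ force D_{ℓ+2} + D_{ℓ+1} to rise.  Hence D_{ℓ+4} has a peak at μ₃ or
-- μ₃ + 1, and the window of four ordered peaks slides forever.
module Submission where

open import Defs
open import Data.Nat using (ℕ; zero; suc; pred; _+_; _≤_; _≤?_; _≡ᵇ_; z≤n; s≤s)
open import Data.Product using (_×_; _,_; proj₁; proj₂; ∃)

open import Data.Bool using (Bool; true; false; T; _∧_; _∨_)
open import Data.Bool.Properties
  using (∧-assoc; ∨-assoc; ∧-comm; ∧-zeroʳ; ∧-identityʳ; ∨-zeroʳ; ∨-identityʳ; T-∧)
open import Data.Empty using (⊥-elim)
open import Data.Fin using (Fin; toℕ; _↑ˡ_; _↑ʳ_) renaming (zero to fzero; suc to fsuc)
open import Data.Fin.Properties using (all?; any?; splitAt-↑ˡ; splitAt-↑ʳ)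
open import Data.Fin.Subset using (Subset; ∣_∣; inside; outside)
open import Data.Fin.Subset.Properties using (_∈?_)
open import Data.List using (List; []; _∷_; length; map; filter; filterᵇ) renaming (_++_ to _++ₗ_)
open import Data.List.Properties using (length-++; length-map; filter-++; filter-none)
open import Data.List.Relation.Unary.All using (universal)
open import Data.Nat.Properties
  using ( ≤-refl; ≤-trans; ≤-pred; n≤1+n; <⇒≤; ≰⇒>; pred[n]≤n; m≤n⇒m<n∨m≡n
        ; +-assoc; +-mono-≤; +-monoʳ-≤; +-cancelʳ-≤; +-cancelʳ-≡; m+n≡0⇒m≡0; module ≤-Reasoning)
open import Data.Nat.Tactic.RingSolver using (solve-∀)
open import Data.Sum using (inj₁; inj₂)
open import Data.Vec using (Vec; []; _∷_; lookup; _++_)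
open import Data.Vec.Properties using (lookup-++ˡ; lookup-++ʳ)
open import Function using (_∘_; Equivalence)
open import Relation.Nullary using (does; yes; no)
open import Relation.Nullary.Decidable using (T?; _×-dec_; _⊎-dec_)
open import Relation.Unary using (Pred; Decidable)
open import Relation.Binary.PropositionalEquality
  using (_≡_; _≗_; refl; trans; cong; cong₂; cong-app; subst₂; module ≡-Reasoning)
import Relation.Binary.PropositionalEquality as ≡

-- Polynomials over ℕ

-- A polynomial is its coefficient sequence; x* p is x · p.
Poly : Set
Poly = ℕ → ℕ

infixl 6 _⊕_
infixr 7 x*_

0ₚ : Poly
0ₚ _ = 0

1ₚ : Poly
1ₚ zero    = 1
1ₚ (suc _) = 0

_⊕_ : Poly → Poly → Poly
(p ⊕ q) i = p i + q i

x*_ : Poly → Poly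
(x* p) zero    = 0
(x* p) (suc i) = p i

when : Bool → Poly → Poly
when true  p = p
when false p = 0ₚ

𝟙 : Bool → Poly
𝟙 b = when b 1ₚ

x*-cong : ∀ {p q} → p ≗ q → x* p ≗ x* q
x*-cong p≗q zero    = refl
x*-cong p≗q (suc i) = p≗q i

x*-⊕ : ∀ p q → x* (p ⊕ q) ≗ x* p ⊕ x* q
x*-⊕ p q zero    = refl
x*-⊕ p q (suc i) = refl

when-cong : ∀ b {p q} → p ≗ q → when b p ≗ when b q
when-cong true  p≗q   = p≗q
when-cong false p≗q i = refl

𝟙-∧ : ∀ b c → 𝟙 (b ∧ c) ≡ when b (𝟙 c)
𝟙-∧ true  c = refl
𝟙-∧ false c = refl

-- sumSubsets m F = Σ_{U ⊆ Fin m} x^|U| · F U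
sumSubsets : (m : ℕ) → (Subset m → Poly) → Poly
sumSubsets zero    F = F []
sumSubsets (suc m) F = sumSubsets m (F ∘ (outside ∷_)) ⊕ x* sumSubsets m (F ∘ (inside ∷_))

sumSubsets-cong : ∀ m {F G : Subset m → Poly} → (∀ U → F U ≗ G U) → sumSubsets m F ≗ sumSubsets m G
sumSubsets-cong zero    F≗G i       = F≗G [] i
sumSubsets-cong (suc m) F≗G zero    = cong (_+ 0) (sumSubsets-cong m (F≗G ∘ (outside ∷_)) zero)
sumSubsets-cong (suc m) F≗G (suc i) =
  cong₂ _+_ (sumSubsets-cong m (F≗G ∘ (outside ∷_)) (suc i)) (sumSubsets-cong m (F≗G ∘ (inside ∷_)) i)

sumSubsets-0ₚ : ∀ m → sumSubsets m (λ _ → 0ₚ) ≗ 0ₚ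
sumSubsets-0ₚ zero    i       = refl
sumSubsets-0ₚ (suc m) zero    = cong (_+ 0) (sumSubsets-0ₚ m zero)
sumSubsets-0ₚ (suc m) (suc i) = cong₂ _+_ (sumSubsets-0ₚ m (suc i)) (sumSubsets-0ₚ m i)

sumSubsets-when : ∀ m b (F : Subset m → Poly) → sumSubsets m (when b ∘ F) ≗ when b (sumSubsets m F)
sumSubsets-when m true  F i = refl
sumSubsets-when m false F i = sumSubsets-0ₚ m i

sumSubsets-++ : ∀ m k (F : Subset (m + k) → Poly) →
                sumSubsets (m + k) F ≗ sumSubsets m (λ U → sumSubsets k (λ W → F (U ++ W)))
sumSubsets-++ zero    k F i = refl
sumSubsets-++ (suc m) k F i =
  cong₂ _+_ (sumSubsets-++ m k (F ∘ (outside ∷_)) i) (x*-cong (sumSubsets-++ m k (F ∘ (inside ∷_))) i)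

-- Counting dominating sets

filterᵇ-map : ∀ {A B : Set} (p : B → Bool) (f : A → B) xs →
              filterᵇ p (map f xs) ≡ map f (filterᵇ (p ∘ f) xs)
filterᵇ-map p f []       = refl
filterᵇ-map p f (x ∷ xs) with p (f x)
... | true  = cong (f x ∷_) (filterᵇ-map p f xs)
... | false = filterᵇ-map p f xs

filter-does : ∀ {a p} {A : Set a} {P : Pred A p} (P? : Decidable P) {q : A → Bool} →
              (∀ x → does (P? x) ≡ q x) → filter P? ≗ filterᵇ q
filter-does P? eq []       = refl
filter-does P? {q} eq (x ∷ xs) with does (P? x) | q x | eq x
... | true  | .true  | refl = cong (x ∷_) (filter-does P? eq xs)
... | false | .false | refl = filter-does P? eq xs

length-filter-allSubsets : ∀ m (p : Subset m → Bool) i →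
  length (filterᵇ (λ U → (∣ U ∣ ≡ᵇ i) ∧ p U) (allSubsets m)) ≡ sumSubsets m (𝟙 ∘ p) i
length-filter-allSubsets zero p i with p []
length-filter-allSubsets zero p zero    | true  = refl
length-filter-allSubsets zero p (suc i) | true  = refl
length-filter-allSubsets zero p zero    | false = refl
length-filter-allSubsets zero p (suc i) | false = refl
length-filter-allSubsets (suc m) p i = begin
    length (filterᵇ P (map (outside ∷_) S ++ₗ map (inside ∷_) S))
  ≡⟨ cong length (filter-++ (T? ∘ P) (map (outside ∷_) S) (map (inside ∷_) S)) ⟩
    length (filterᵇ P (map (outside ∷_) S) ++ₗ filterᵇ P (map (inside ∷_) S))
  ≡⟨ length-++ (filterᵇ P (map (outside ∷_) S)) ⟩
    length (filterᵇ P (map (outside ∷_) S)) + length (filterᵇ P (map (inside ∷_) S))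
  ≡⟨ cong₂ _+_ (length-filterᵇ-map (outside ∷_)) (length-filterᵇ-map (inside ∷_)) ⟩
    length (filterᵇ (P ∘ (outside ∷_)) S) + length (filterᵇ (P ∘ (inside ∷_)) S)
  ≡⟨ cong₂ _+_ (length-filter-allSubsets m (p ∘ (outside ∷_)) i) (insideCount i) ⟩
    sumSubsets (suc m) (𝟙 ∘ p) i
  ∎
  where
  open ≡-Reasoning
  S : List (Subset m)
  S = allSubsets m
  P : Subset (suc m) → Bool
  P U = (∣ U ∣ ≡ᵇ i) ∧ p U
  length-filterᵇ-map : ∀ f → length (filterᵇ P (map f S)) ≡ length (filterᵇ (P ∘ f) S)
  length-filterᵇ-map f = trans (cong length (filterᵇ-map P f S)) (length-map f (filterᵇ (P ∘ f) S))
  insideCount : ∀ i → length (filterᵇ (λ U → (∣ inside ∷ U ∣ ≡ᵇ i) ∧ p (inside ∷ U)) S)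
                    ≡ (x* sumSubsets m (𝟙 ∘ p ∘ (inside ∷_))) i
  insideCount zero    = cong length (filter-none (T? ∘ λ _ → false) (universal (λ _ ()) S))
  insideCount (suc i) = length-filter-allSubsets m (p ∘ (inside ∷_)) i

allᵇ : (n : ℕ) → (Fin n → Bool) → Bool
allᵇ zero    f = true
allᵇ (suc n) f = f fzero ∧ allᵇ n (f ∘ fsuc)

anyᵇ : (n : ℕ) → (Fin n → Bool) → Bool
anyᵇ zero    f = false
anyᵇ (suc n) f = f fzero ∨ anyᵇ n (f ∘ fsuc)

allᵇ-cong : ∀ n {f g : Fin n → Bool} → f ≗ g → allᵇ n f ≡ allᵇ n g
allᵇ-cong zero    f≗g = refl
allᵇ-cong (suc n) f≗g = cong₂ _∧_ (f≗g fzero) (allᵇ-cong n (f≗g ∘ fsuc))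

anyᵇ-cong : ∀ n {f g : Fin n → Bool} → f ≗ g → anyᵇ n f ≡ anyᵇ n g
anyᵇ-cong zero    f≗g = refl
anyᵇ-cong (suc n) f≗g = cong₂ _∨_ (f≗g fzero) (anyᵇ-cong n (f≗g ∘ fsuc))

allᵇ-mono : ∀ n {f g : Fin n → Bool} → (∀ i → T (f i) → T (g i)) → T (allᵇ n f) → T (allᵇ n g)
allᵇ-mono zero    f⇒g _ = _
allᵇ-mono (suc n) f⇒g p = let p₀ , p₁ = Equivalence.to T-∧ p in
  Equivalence.from T-∧ (f⇒g fzero p₀ , allᵇ-mono n (f⇒g ∘ fsuc) p₁)

allᵇ-++ : ∀ m k (f : Fin (m + k) → Bool) → allᵇ (m + k) f ≡ allᵇ m (f ∘ (_↑ˡ k)) ∧ allᵇ k (f ∘ (m ↑ʳ_))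
allᵇ-++ zero    k f = refl
allᵇ-++ (suc m) k f = trans (cong (f fzero ∧_) (allᵇ-++ m k (f ∘ fsuc))) (≡.sym (∧-assoc (f fzero) _ _))

anyᵇ-++ : ∀ m k (f : Fin (m + k) → Bool) → anyᵇ (m + k) f ≡ anyᵇ m (f ∘ (_↑ˡ k)) ∨ anyᵇ k (f ∘ (m ↑ʳ_))
anyᵇ-++ zero    k f = refl
anyᵇ-++ (suc m) k f = trans (cong (f fzero ∨_) (anyᵇ-++ m k (f ∘ fsuc))) (≡.sym (∨-assoc (f fzero) _ _))

anyᵇ-false : ∀ m {f : Fin m → Bool} → f ≗ (λ _ → false) → anyᵇ m f ≡ false
anyᵇ-false zero    f≗false = refl
anyᵇ-false (suc m) f≗false = cong₂ _∨_ (f≗false fzero) (anyᵇ-false m (f≗false ∘ fsuc))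

does-all? : ∀ {n p} {P : Pred (Fin n) p} (P? : Decidable P) → does (all? P?) ≡ allᵇ n (does ∘ P?)
does-all? {zero}  P? = refl
does-all? {suc n} P? = cong (does (P? fzero) ∧_) (does-all? (P? ∘ fsuc))

does-any? : ∀ {n p} {P : Pred (Fin n) p} (P? : Decidable P) → does (any? P?) ≡ anyᵇ n (does ∘ P?)
does-any? {zero}  P? = refl
does-any? {suc n} P? = cong (does (P? fzero) ∨_) (does-any? (P? ∘ fsuc))

does-∈? : ∀ {n} (x : Fin n) (U : Subset n) → does (x ∈? U) ≡ lookup U x
does-∈? fzero    (inside  ∷ U) = refl
does-∈? fzero    (outside ∷ U) = refl
does-∈? (fsuc x) (_ ∷ U)       = does-∈? x U

does-Adj? : ∀ H x y → does (Adj? H x y) ≡ adj H x y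
does-Adj? H x y with adj H x y
... | true  = refl
... | false = refl

dominates : (H : Graph) → Subset (n H) → Bool
dominates H U = allᵇ (n H) λ x → lookup U x ∨ anyᵇ (n H) λ y → lookup U y ∧ adj H x y

does-dominating? : ∀ H U → does (dominating? H U) ≡ dominates H U
does-dominating? H U = trans (does-all? (λ x → (x ∈? U) ⊎-dec any? (λ y → (y ∈? U) ×-dec Adj? H x y)))
  (allᵇ-cong (n H) λ x → cong₂ _∨_ (does-∈? x U)
    (trans (does-any? (λ y → (y ∈? U) ×-dec Adj? H x y)) (anyᵇ-cong (n H) λ y →
      cong₂ _∧_ (does-∈? y U) (does-Adj? H x y))))

d-sumSubsets : ∀ H → d H ≗ sumSubsets (n H) (𝟙 ∘ dominates H)
d-sumSubsets H i = trans
  (cong length (filter-does _ (λ U → cong ((∣ U ∣ ≡ᵇ i) ∧_) (does-dominating? H U)) (allSubsets (n H))))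
  (length-filter-allSubsets (n H) (dominates H) i)

firstIn : ∀ {k} → Vec Bool k → Bool
firstIn []      = false
firstIn (c ∷ _) = c

-- W ⊆ {p₀, …, p_{k-1}} dominates every path vertex, where e says whether p₀'s
-- predecessor (v, or p_{i-1} in the recursive call) is chosen.
pathDominated : ∀ {k} → Bool → Vec Bool k → Bool
pathDominated e []      = true
pathDominated e (c ∷ W) = (c ∨ (e ∨ firstIn W)) ∧ pathDominated c W

-- U dominates G, where v also counts as dominated if t (i.e. if p₀ is chosen).
dominatesHelped : (G : Graph) → V G → Subset (n G) → Bool → Bool
dominatesHelped G v U t = allᵇ (n G) λ a →
  lookup U a ∨ (anyᵇ (n G) (λ b → lookup U b ∧ adj G a b) ∨ ((toℕ a == toℕ v) ∧ t))

zero-== : ∀ x → (0 == x) ≡ (x == 0)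
zero-== zero    = refl
zero-== (suc x) = refl

anyᵇ-at : ∀ m (U : Vec Bool m) v t → anyᵇ m (λ b → lookup U b ∧ ((toℕ b == toℕ v) ∧ t)) ≡ lookup U v ∧ t
anyᵇ-at (suc m) (c ∷ U) fzero    t = trans
  (cong ((c ∧ t) ∨_) (anyᵇ-false m λ b → ∧-zeroʳ (lookup U b))) (∨-identityʳ (c ∧ t))
anyᵇ-at (suc m) (c ∷ U) (fsuc v) t =
  trans (cong (_∨ anyᵇ m (λ b → lookup U b ∧ ((toℕ b == toℕ v) ∧ t))) (∧-zeroʳ c)) (anyᵇ-at m U v t)

anyᵇ-first : ∀ k (W : Vec Bool k) t → anyᵇ k (λ q → lookup W q ∧ (t ∧ (toℕ q == 0))) ≡ t ∧ firstIn W
anyᵇ-first zero    []      t = ≡.sym (∧-zeroʳ t)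
anyᵇ-first (suc k) (c ∷ W) t = begin
    (c ∧ (t ∧ true)) ∨ anyᵇ k (λ q → lookup W q ∧ (t ∧ false))
  ≡⟨ cong₂ _∨_ (cong (c ∧_) (∧-identityʳ t))
               (anyᵇ-false k λ q → trans (cong (lookup W q ∧_) (∧-zeroʳ t)) (∧-zeroʳ _)) ⟩
    (c ∧ t) ∨ false
  ≡⟨ trans (∨-identityʳ (c ∧ t)) (∧-comm c t) ⟩
    t ∧ c
  ∎
  where open ≡-Reasoning

allᵇ-pathDominated : ∀ k (W : Vec Bool k) e →
  allᵇ k (λ p → lookup W p ∨ ((e ∧ (toℕ p == 0)) ∨ anyᵇ k (λ q → lookup W q ∧ consec (toℕ p) (toℕ q))))
    ≡ pathDominated e W
allᵇ-pathDominated zero    []      e = refl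
allᵇ-pathDominated (suc k) (c ∷ W) e =
  cong₂ _∧_ firstVertex (trans (allᵇ-cong k laterVertex) (allᵇ-pathDominated k W c))
  where
  anyᵇ-firstIn : anyᵇ k (λ q → lookup W q ∧ ((0 == toℕ q) ∨ false)) ≡ firstIn W
  anyᵇ-firstIn = trans
    (anyᵇ-cong k λ q → cong (lookup W q ∧_) (trans (∨-identityʳ _) (zero-== (toℕ q))))
    (anyᵇ-first k W true)
  firstVertex : c ∨ ((e ∧ true) ∨ ((c ∧ false) ∨ anyᵇ k (λ q → lookup W q ∧ ((0 == toℕ q) ∨ false))))
              ≡ c ∨ (e ∨ firstIn W)
  firstVertex rewrite ∧-identityʳ e | ∧-zeroʳ c | anyᵇ-firstIn = refl
  laterVertex : ∀ p →
      lookup W p ∨ ((e ∧ false) ∨ ((c ∧ (0 == toℕ p)) ∨ anyᵇ k (λ q → lookup W q ∧ consec (toℕ p) (toℕ q))))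
    ≡ lookup W p ∨ ((c ∧ (toℕ p == 0)) ∨ anyᵇ k (λ q → lookup W q ∧ consec (toℕ p) (toℕ q)))
  laterVertex p rewrite ∧-zeroʳ e | zero-== (toℕ p) = refl

module _ (G : Graph) (v : V G) (k : ℕ) where

  extAdj-ˡˡ : ∀ a b → extAdj G v k (a ↑ˡ k) (b ↑ˡ k) ≡ adj G a b
  extAdj-ˡˡ a b rewrite splitAt-↑ˡ (n G) a k | splitAt-↑ˡ (n G) b k = refl

  extAdj-ˡʳ : ∀ a q → extAdj G v k (a ↑ˡ k) (n G ↑ʳ q) ≡ (toℕ a == toℕ v) ∧ (toℕ q == 0)
  extAdj-ˡʳ a q rewrite splitAt-↑ˡ (n G) a k | splitAt-↑ʳ (n G) k q = refl

  extAdj-ʳˡ : ∀ p b → extAdj G v k (n G ↑ʳ p) (b ↑ˡ k) ≡ (toℕ b == toℕ v) ∧ (toℕ p == 0)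
  extAdj-ʳˡ p b rewrite splitAt-↑ʳ (n G) k p | splitAt-↑ˡ (n G) b k = refl

  extAdj-ʳʳ : ∀ p q → extAdj G v k (n G ↑ʳ p) (n G ↑ʳ q) ≡ consec (toℕ p) (toℕ q)
  extAdj-ʳʳ p q rewrite splitAt-↑ʳ (n G) k p | splitAt-↑ʳ (n G) k q = refl

  dominates-attachPath : ∀ U W →
    dominates (attachPath G v k) (U ++ W) ≡ dominatesHelped G v U (firstIn W) ∧ pathDominated (lookup U v) W
  dominates-attachPath U W = trans (allᵇ-++ (n G) k _)
    (cong₂ _∧_ (allᵇ-cong (n G) oldVertex)
               (trans (allᵇ-cong k newVertex) (allᵇ-pathDominated k W (lookup U v))))
    where
    X : Subset (n G + k)
    X = U ++ W
    neighbourIn : Fin (n G + k) → Fin (n G + k) → Bool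
    neighbourIn x y = lookup X y ∧ extAdj G v k x y
    oldVertex : ∀ a → lookup X (a ↑ˡ k) ∨ anyᵇ (n G + k) (neighbourIn (a ↑ˡ k))
              ≡ lookup U a ∨ (anyᵇ (n G) (λ b → lookup U b ∧ adj G a b) ∨ ((toℕ a == toℕ v) ∧ firstIn W))
    oldVertex a = cong₂ _∨_ (lookup-++ˡ U W a) (trans (anyᵇ-++ (n G) k _) (cong₂ _∨_
      (anyᵇ-cong (n G) λ b → cong₂ _∧_ (lookup-++ˡ U W b) (extAdj-ˡˡ a b))
      (trans (anyᵇ-cong k λ q → cong₂ _∧_ (lookup-++ʳ U W q) (extAdj-ˡʳ a q)) (anyᵇ-first k W _))))
    newVertex : ∀ p → lookup X (n G ↑ʳ p) ∨ anyᵇ (n G + k) (neighbourIn (n G ↑ʳ p))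
              ≡ lookup W p ∨ ((lookup U v ∧ (toℕ p == 0)) ∨ anyᵇ k (λ q → lookup W q ∧ consec (toℕ p) (toℕ q)))
    newVertex p = cong₂ _∨_ (lookup-++ʳ U W p) (trans (anyᵇ-++ (n G) k _) (cong₂ _∨_
      (trans (anyᵇ-cong (n G) λ b → cong₂ _∧_ (lookup-++ˡ U W b) (extAdj-ʳˡ p b)) (anyᵇ-at (n G) U v _))
      (anyᵇ-cong k λ q → cong₂ _∧_ (lookup-++ʳ U W q) (extAdj-ʳʳ p q))))

implication-∧ : ∀ {a b} → (T a → T b) → a ≡ b ∧ a
implication-∧ {true}  {true}  _   = refl
implication-∧ {true}  {false} a⇒b = ⊥-elim (a⇒b _)
implication-∧ {false} {b}     _   = ≡.sym (∧-zeroʳ b)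

module _ (G : Graph) (v : V G) where

  dominatesHelped-mono : ∀ U → T (dominatesHelped G v U false) → T (dominatesHelped G v U true)
  dominatesHelped-mono U = allᵇ-mono (n G) λ a →
    mono (lookup U a) (anyᵇ (n G) λ b → lookup U b ∧ adj G a b) (toℕ a == toℕ v)
    where
    mono : ∀ x y c → T (x ∨ (y ∨ (c ∧ false))) → T (x ∨ (y ∨ (c ∧ true)))
    mono true  _     _     _ = _
    mono false true  _     _ = _
    mono false false true  ()
    mono false false false ()

  dominatesHelped-split : ∀ U t →
    dominatesHelped G v U t ≡ dominatesHelped G v U true ∧ (dominatesHelped G v U false ∨ t)
  dominatesHelped-split U = split
    where
    h₀ = dominatesHelped G v U false
    h₁ = dominatesHelped G v U true
    split : ∀ t → dominatesHelped G v U t ≡ h₁ ∧ (h₀ ∨ t)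
    split true  = ≡.sym (trans (cong (h₁ ∧_) (∨-zeroʳ h₀)) (∧-identityʳ h₁))
    split false = trans (implication-∧ (dominatesHelped-mono U)) (cong (h₁ ∧_) (≡.sym (∨-identityʳ h₀)))

  dominates-unhelped : ∀ U → dominates G U ≡ dominatesHelped G v U false
  dominates-unhelped U = allᵇ-cong (n G) λ a → cong (lookup U a ∨_) (≡.sym (trans
    (cong (anyᵇ (n G) (λ b → lookup U b ∧ adj G a b) ∨_) (∧-zeroʳ (toℕ a == toℕ v)))
    (∨-identityʳ _)))

-- The recurrence

Recurrent : (ℕ → Poly) → Set
Recurrent P = ∀ k → P (3 + k) ≗ x* (P (2 + k) ⊕ P (1 + k) ⊕ P k)

+-interchange₃ : ∀ a b c d e f → (a + b + c) + (d + e + f) ≡ (a + d) + (b + e) + (c + f)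
+-interchange₃ = solve-∀

+-reverse₃ : ∀ a b c → a + b + c ≡ c + b + a
+-reverse₃ = solve-∀

Recurrent-⊕ : ∀ {P Q} → Recurrent P → Recurrent Q → Recurrent (λ k → P k ⊕ Q k)
Recurrent-⊕ rP rQ k zero = cong₂ _+_ (rP k zero) (rQ k zero)
Recurrent-⊕ {P} {Q} rP rQ k (suc j) = trans (cong₂ _+_ (rP k (suc j)) (rQ k (suc j)))
  (+-interchange₃ (P (2 + k) j) (P (1 + k) j) (P k j) (Q (2 + k) j) (Q (1 + k) j) (Q k j))

Recurrent-x* : ∀ {P} → Recurrent P → Recurrent (x*_ ∘ P)
Recurrent-x* rP k zero = refl
Recurrent-x* {P} rP k (suc j) = trans (rP k j)
  (trans (x*-⊕ (P (2 + k) ⊕ P (1 + k)) (P k) j) (cong (_+ (x* P k) j) (x*-⊕ (P (2 + k)) (P (1 + k)) j)))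

Recurrent-when : ∀ {P} b → Recurrent P → Recurrent (when b ∘ P)
Recurrent-when true  rP         = rP
Recurrent-when false rP k zero    = refl
Recurrent-when false rP k (suc j) = refl

Recurrent-cancel : ∀ {P Q} → Recurrent (λ k → P k ⊕ Q k) → Recurrent Q → Recurrent P
Recurrent-cancel {P} rPQ rQ k zero = m+n≡0⇒m≡0 (P (3 + k) zero) (rPQ k zero)
Recurrent-cancel {P} {Q} rPQ rQ k (suc j) = +-cancelʳ-≡ (Q (2 + k) j + Q (1 + k) j + Q k j) _ _ (begin
    P (3 + k) (suc j) + (Q (2 + k) j + Q (1 + k) j + Q k j)
  ≡⟨ cong (P (3 + k) (suc j) +_) (≡.sym (rQ k (suc j))) ⟩
    P (3 + k) (suc j) + Q (3 + k) (suc j)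
  ≡⟨ rPQ k (suc j) ⟩
    (P (2 + k) j + Q (2 + k) j) + (P (1 + k) j + Q (1 + k) j) + (P k j + Q k j)
  ≡⟨ ≡.sym (+-interchange₃ (P (2 + k) j) (P (1 + k) j) (P k j) (Q (2 + k) j) (Q (1 + k) j) (Q k j)) ⟩
    (P (2 + k) j + P (1 + k) j + P k j) + (Q (2 + k) j + Q (1 + k) j + Q k j)
  ∎)
  where open ≡-Reasoning

Recurrent-sumSubsets : ∀ m {F : Subset m → ℕ → Poly} → (∀ U → Recurrent (F U)) →
                       Recurrent (λ k → sumSubsets m (λ U → F U k))
Recurrent-sumSubsets zero    rF = rF []
Recurrent-sumSubsets (suc m) {F} rF = Recurrent-⊕ {Fₒ} {x*_ ∘ Fᵢ}
  (Recurrent-sumSubsets m (rF ∘ (outside ∷_))) (Recurrent-x* {Fᵢ} (Recurrent-sumSubsets m (rF ∘ (inside ∷_))))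
  where
  Fₒ Fᵢ : ℕ → Poly
  Fₒ k = sumSubsets m (λ U → F (outside ∷ U) k)
  Fᵢ k = sumSubsets m (λ U → F (inside ∷ U) k)

-- The W-sum in which p₀'s predecessor is chosen iff a and already dominated iff b
-- (sumSubsets-pathDominated); the recursion splits on whether p₀ ∈ W.
pathPoly : ℕ → Bool → Bool → Poly
pathPoly zero    a b = 𝟙 b
pathPoly (suc k) a b = when b (pathPoly k false a) ⊕ x* pathPoly k true true

sumSubsets-pathDominated : ∀ k a b →
  sumSubsets k (λ W → 𝟙 ((b ∨ firstIn W) ∧ pathDominated a W)) ≗ pathPoly k a b
sumSubsets-pathDominated zero    a true  i = refl
sumSubsets-pathDominated zero    a false i = refl
sumSubsets-pathDominated (suc k) a true  i =
  cong₂ _+_ (sumSubsets-pathDominated k false a i) (x*-cong (sumSubsets-pathDominated k true true) i)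
sumSubsets-pathDominated (suc k) a false i =
  cong₂ _+_ (sumSubsets-0ₚ k i) (x*-cong (sumSubsets-pathDominated k true true) i)

pathPoly-unhelped : ∀ k a → pathPoly k a false ≡ pathPoly k false false
pathPoly-unhelped zero    a = refl
pathPoly-unhelped (suc k) a = refl

Recurrent-pathPoly-chosen : Recurrent (λ k → pathPoly k true true)
Recurrent-pathPoly-chosen k zero    = refl
Recurrent-pathPoly-chosen k (suc j) =
  +-reverse₃ (pathPoly k true true j) (pathPoly (1 + k) true true j) (pathPoly (2 + k) true true j)

Recurrent-pathPoly-unhelped : ∀ a → Recurrent (λ k → pathPoly k a false)
Recurrent-pathPoly-unhelped a k zero = refl
Recurrent-pathPoly-unhelped a k (suc j) rewrite pathPoly-unhelped k a =
  +-reverse₃ (pathPoly k false false j) ((x* pathPoly k true true) j) ((x* pathPoly (1 + k) true true) j)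

-- The case (false, true) cancels x* pathPoly k true true from pathPoly (suc k) true true.
Recurrent-pathPoly : ∀ a b → Recurrent (λ k → pathPoly k a b)
Recurrent-pathPoly true  true  = Recurrent-pathPoly-chosen
Recurrent-pathPoly false true  = Recurrent-cancel {λ k → pathPoly k false true} {λ k → x* pathPoly k true true}
  (Recurrent-pathPoly-chosen ∘ suc) (Recurrent-x* Recurrent-pathPoly-chosen)
Recurrent-pathPoly a     false = Recurrent-pathPoly-unhelped a

module _ (G : Graph) (v : V G) where

  attachPathPoly : ℕ → Poly
  attachPathPoly ℓ = sumSubsets (n G) λ U →
    when (dominatesHelped G v U true) (pathPoly ℓ (lookup U v) (dominatesHelped G v U false))

  Recurrent-attachPathPoly : Recurrent attachPathPoly
  Recurrent-attachPathPoly = Recurrent-sumSubsets (n G) λ U →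
    Recurrent-when (dominatesHelped G v U true) (Recurrent-pathPoly (lookup U v) (dominatesHelped G v U false))

  d-attachPath : ∀ ℓ → d (attachPath G v ℓ) ≗ attachPathPoly ℓ
  d-attachPath ℓ i = begin
      d (attachPath G v ℓ) i
    ≡⟨ d-sumSubsets (attachPath G v ℓ) i ⟩
      sumSubsets (n G + ℓ) (𝟙 ∘ dominates (attachPath G v ℓ)) i
    ≡⟨ sumSubsets-++ (n G) ℓ _ i ⟩
      sumSubsets (n G) (λ U → sumSubsets ℓ (λ W → 𝟙 (dominates (attachPath G v ℓ) (U ++ W)))) i
    ≡⟨ sumSubsets-cong (n G) sumOverPath i ⟩
      attachPathPoly ℓ i
    ∎
    where
    open ≡-Reasoning
    h₀ h₁ : Subset (n G) → Bool
    h₀ U = dominatesHelped G v U false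
    h₁ U = dominatesHelped G v U true
    integrand : ∀ U W → 𝟙 (dominates (attachPath G v ℓ) (U ++ W))
                      ≡ when (h₁ U) (𝟙 ((h₀ U ∨ firstIn W) ∧ pathDominated (lookup U v) W))
    integrand U W = begin
        𝟙 (dominates (attachPath G v ℓ) (U ++ W))
      ≡⟨ cong 𝟙 (dominates-attachPath G v ℓ U W) ⟩
        𝟙 (dominatesHelped G v U (firstIn W) ∧ pathDominated (lookup U v) W)
      ≡⟨ cong (λ b → 𝟙 (b ∧ pathDominated (lookup U v) W)) (dominatesHelped-split G v U (firstIn W)) ⟩
        𝟙 ((h₁ U ∧ (h₀ U ∨ firstIn W)) ∧ pathDominated (lookup U v) W)
      ≡⟨ cong 𝟙 (∧-assoc (h₁ U) _ _) ⟩
        𝟙 (h₁ U ∧ ((h₀ U ∨ firstIn W) ∧ pathDominated (lookup U v) W))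
      ≡⟨ 𝟙-∧ (h₁ U) _ ⟩
        when (h₁ U) (𝟙 ((h₀ U ∨ firstIn W) ∧ pathDominated (lookup U v) W))
      ∎
    sumOverPath : ∀ U → sumSubsets ℓ (λ W → 𝟙 (dominates (attachPath G v ℓ) (U ++ W)))
                      ≗ when (h₁ U) (pathPoly ℓ (lookup U v) (h₀ U))
    sumOverPath U j = trans (sumSubsets-cong ℓ (cong-app ∘ integrand U) j)
      (trans (sumSubsets-when ℓ (h₁ U) _ j) (when-cong (h₁ U) (sumSubsets-pathDominated ℓ (lookup U v) (h₀ U)) j))

  d-attachPathPoly-zero : d G ≗ attachPathPoly 0
  d-attachPathPoly-zero i = trans (d-sumSubsets G i) (sumSubsets-cong (n G) (λ U → cong-app (begin
      𝟙 (dominates G U)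
    ≡⟨ cong 𝟙 (dominates-unhelped G v U) ⟩
      𝟙 (dominatesHelped G v U false)
    ≡⟨ cong 𝟙 (implication-∧ (dominatesHelped-mono G v U)) ⟩
      𝟙 (dominatesHelped G v U true ∧ dominatesHelped G v U false)
    ≡⟨ 𝟙-∧ (dominatesHelped G v U true) _ ⟩
      when (dominatesHelped G v U true) (𝟙 (dominatesHelped G v U false))
    ∎)) i)
    where open ≡-Reasoning

-- Peaks

Ascending : Poly → ℕ → Set
Ascending f m = ∀ i → suc i ≤ m → f i ≤ f (suc i)

Descending : Poly → ℕ → Set
Descending f m = ∀ i → m ≤ i → f (suc i) ≤ f i

Peak : Poly → ℕ → Set
Peak f m = Ascending f m × Descending f m

Ascending-≤ : ∀ {f m n} → m ≤ n → Ascending f n → Ascending f m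
Ascending-≤ m≤n up i i<m = up i (≤-trans i<m m≤n)

Descending-≤ : ∀ {f m n} → m ≤ n → Descending f m → Descending f n
Descending-≤ m≤n down i n≤i = down i (≤-trans m≤n n≤i)

Ascending-⊕ : ∀ {f g m} → Ascending f m → Ascending g m → Ascending (f ⊕ g) m
Ascending-⊕ up-f up-g i i<m = +-mono-≤ (up-f i i<m) (up-g i i<m)

Descending-⊕ : ∀ {f g m} → Descending f m → Descending g m → Descending (f ⊕ g) m
Descending-⊕ down-f down-g i m≤i = +-mono-≤ (down-f i m≤i) (down-g i m≤i)

Ascending-extend : ∀ {f m} → Ascending f m → f m ≤ f (suc m) → Ascending f (suc m)
Ascending-extend up step i i<sm with m≤n⇒m<n∨m≡n (≤-pred i<sm)
... | inj₁ i<m  = up i i<m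
... | inj₂ refl = step

Descending-extend : ∀ {f m} → Descending f (suc m) → f (suc m) ≤ f m → Descending f m
Descending-extend down step i m≤i with m≤n⇒m<n∨m≡n m≤i
... | inj₁ m<i  = down i m<i
... | inj₂ refl = step

Peak-cong : ∀ {f g m} → f ≗ g → Peak f m → Peak g m
Peak-cong f≗g (up , down) =
  (λ i i<m → subst₂ _≤_ (f≗g i) (f≗g (suc i)) (up i i<m)) ,
  (λ i m≤i → subst₂ _≤_ (f≗g (suc i)) (f≗g i) (down i m≤i))

Peak-x* : ∀ {f m} → Peak f m → Peak (x* f) (suc m)
Peak-x* {f} {m} (up , down) = up′ , down′
  where
  up′ : Ascending (x* f) (suc m)
  up′ zero    _     = z≤n
  up′ (suc i) si<sm = up i (≤-pred si<sm)
  down′ : Descending (x* f) (suc m)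
  down′ (suc i) sm≤si = down i (≤-pred sm≤si)

unimodal⇒Peak : ∀ {f μ} → Unimodal f → ModeAt f μ → Peak f μ
unimodal⇒Peak {f} {μ} (k , up , down) mode = up′ , down′
  where
  up′ : Ascending f μ
  up′ i i<μ with suc i ≤? k
  ... | yes i<k = up i (suc i) (n≤1+n i) i<k
  ... | no  i≮k = ≤-trans (mode i) (down (suc i) μ (<⇒≤ (≰⇒> i≮k)) i<μ)
  down′ : Descending f μ
  down′ i μ≤i with k ≤? i
  ... | yes k≤i = down i (suc i) k≤i (n≤1+n i)
  ... | no  k≰i = ≤-trans (mode (suc i)) (up μ i μ≤i (<⇒≤ (≰⇒> k≰i)))

Peak⇒unimodal : ∀ {f μ} → Peak f μ → Unimodal f
Peak⇒unimodal {f} {μ} (up , down) = μ , up* , down*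
  where
  up* : ∀ i j → i ≤ j → j ≤ μ → f i ≤ f j
  up* i zero    z≤n  _    = ≤-refl
  up* i (suc j) i≤sj sj≤μ with m≤n⇒m<n∨m≡n i≤sj
  ... | inj₁ i<sj = ≤-trans (up* i j (≤-pred i<sj) (≤-trans (n≤1+n j) sj≤μ)) (up j sj≤μ)
  ... | inj₂ refl = ≤-refl
  down* : ∀ i j → μ ≤ i → i ≤ j → f j ≤ f i
  down* i zero    μ≤i z≤n  = ≤-refl
  down* i (suc j) μ≤i i≤sj with m≤n⇒m<n∨m≡n i≤sj
  ... | inj₁ i<sj = ≤-trans (down j (≤-trans μ≤i (≤-pred i<sj))) (down* i j μ≤i (≤-pred i<sj))
  ... | inj₂ refl = ≤-refl

peak-near : ∀ {f r} → Ascending f (pred r) → Descending f r → ∃ λ s → Peak f s × r ≤ suc s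
peak-near {f} {zero}  up down = zero , ((λ _ ()) , down) , z≤n
peak-near {f} {suc m} up down with f (suc m) ≤? f m
... | yes fall = m , (up , Descending-extend down fall) , ≤-refl
... | no  rise = suc m , (Ascending-extend up (<⇒≤ (≰⇒> rise)) , down) , n≤1+n (suc m)

-- From p on, e (i + 1) = g i + a i rises while a falls, so g must rise.
ascending-before-lag : ∀ {g a e o p r} → Ascending g p → Descending a o → o ≤ p →
                       e ≗ x* (g ⊕ a) → Ascending e r → Ascending g (pred r)
ascending-before-lag {r = zero} _ _ _ _ _ i ()
ascending-before-lag {g} {a} {e} {o} {p} {suc m} up-g down-a o≤p e≗ up-e i i<m with suc i ≤? p
... | yes i<p = up-g i i<p
... | no  i≮p = +-cancelʳ-≤ (a i) (g i) (g (suc i)) (begin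
    g i + a i              ≡⟨ ≡.sym (e≗ (suc i)) ⟩
    e (suc i)              ≤⟨ up-e (suc i) (s≤s i<m) ⟩
    e (suc (suc i))        ≡⟨ e≗ (suc (suc i)) ⟩
    g (suc i) + a (suc i)  ≤⟨ +-monoʳ-≤ (g (suc i)) (down-a i (≤-trans o≤p (≤-pred (≰⇒> i≮p)))) ⟩
    g (suc i) + a i        ∎)
  where open ≤-Reasoning

record PeakWindow (D : ℕ → Poly) (ℓ : ℕ) : Set where
  field
    {μ₀ μ₁ μ₂ μ₃} : ℕ
    peak₀ : Peak (D ℓ) μ₀
    peak₁ : Peak (D (1 + ℓ)) μ₁
    peak₂ : Peak (D (2 + ℓ)) μ₂
    peak₃ : Peak (D (3 + ℓ)) μ₃
    μ₀≤μ₁ : μ₀ ≤ μ₁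
    μ₁≤μ₂ : μ₁ ≤ μ₂
    μ₂≤μ₃ : μ₂ ≤ μ₃

PeakWindow-slide : ∀ {D ℓ} → Recurrent D → PeakWindow D ℓ → PeakWindow D (suc ℓ)
PeakWindow-slide {D} {ℓ} rec w = record
  { peak₀ = peak₁ ; peak₁ = peak₂ ; peak₂ = peak₃
  ; peak₃ = Peak-cong (≡.sym ∘ rec (suc ℓ)) (Peak-x* (Peak-cong reassoc (proj₁ (proj₂ near))))
  ; μ₀≤μ₁ = μ₁≤μ₂ ; μ₁≤μ₂ = μ₂≤μ₃ ; μ₂≤μ₃ = proj₂ (proj₂ near)
  }
  where
  open PeakWindow w
  b c e : Poly
  b = D (1 + ℓ)
  c = D (2 + ℓ)
  e = D (3 + ℓ)
  up-cb : Ascending (c ⊕ b) (pred μ₃)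
  up-cb = ascending-before-lag (Ascending-⊕ (Ascending-≤ μ₁≤μ₂ (proj₁ peak₂)) (proj₁ peak₁))
                               (proj₂ peak₀) μ₀≤μ₁ (rec ℓ) (proj₁ peak₃)
  down-cb : Descending (c ⊕ b) μ₃
  down-cb = Descending-⊕ (Descending-≤ μ₂≤μ₃ (proj₂ peak₂))
                         (Descending-≤ (≤-trans μ₁≤μ₂ μ₂≤μ₃) (proj₂ peak₁))
  near : ∃ λ s → Peak (e ⊕ (c ⊕ b)) s × μ₃ ≤ suc s
  near = peak-near (Ascending-⊕ (Ascending-≤ pred[n]≤n (proj₁ peak₃)) up-cb)
                   (Descending-⊕ (proj₂ peak₃) down-cb)
  reassoc : e ⊕ (c ⊕ b) ≗ e ⊕ c ⊕ b
  reassoc i = ≡.sym (+-assoc (e i) (c i) (b i))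

PeakWindow-all : ∀ {D} → Recurrent D → PeakWindow D 0 → ∀ ℓ → PeakWindow D ℓ
PeakWindow-all rec w₀ zero    = w₀
PeakWindow-all rec w₀ (suc ℓ) = PeakWindow-slide rec (PeakWindow-all rec w₀ ℓ)

lemma3p3 : (G : Graph) (v : V G) (μ₀ μ₁ μ₂ μ₃ : ℕ)
    → Unimodal (d G) × ModeAt (d G) μ₀
    → Unimodal (d (attachPath G v 1)) × ModeAt (d (attachPath G v 1)) μ₁
    → Unimodal (d (attachPath G v 2)) × ModeAt (d (attachPath G v 2)) μ₂
    → Unimodal (d (attachPath G v 3)) × ModeAt (d (attachPath G v 3)) μ₃
    → (μ₀ ≤ μ₁ × μ₁ ≤ μ₀ + 1)
    → (μ₁ ≤ μ₂ × μ₂ ≤ μ₁ + 1)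
    → (μ₂ ≤ μ₃ × μ₃ ≤ μ₂ + 1)
    → (ℓ : ℕ) → Unimodal (d (attachPath G v ℓ))
lemma3p3 G v μ₀ μ₁ μ₂ μ₃ (u₀ , m₀) (u₁ , m₁) (u₂ , m₂) (u₃ , m₃) (μ₀≤μ₁ , _) (μ₁≤μ₂ , _) (μ₂≤μ₃ , _) ℓ =
  Peak⇒unimodal (Peak-cong (≡.sym ∘ d-attachPath G v ℓ)
    (PeakWindow.peak₀ (PeakWindow-all (Recurrent-attachPathPoly G v) w₀ ℓ)))
  where
  w₀ : PeakWindow (attachPathPoly G v) 0
  w₀ = record
    { peak₀ = Peak-cong (d-attachPathPoly-zero G v) (unimodal⇒Peak u₀ m₀)
    ; peak₁ = Peak-cong (d-attachPath G v 1) (unimodal⇒Peak u₁ m₁)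
    ; peak₂ = Peak-cong (d-attachPath G v 2) (unimodal⇒Peak u₂ m₂)
    ; peak₃ = Peak-cong (d-attachPath G v 3) (unimodal⇒Peak u₃ m₃)
    ; μ₀≤μ₁ = μ₀≤μ₁ ; μ₁≤μ₂ = μ₁≤μ₂ ; μ₂≤μ₃ = μ₂≤μ₃
    }
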